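{- Let $\rho$ be a uniform replacement and $\varphi,\psi$ any formulas. Then: (a) if $\vdash_{\mathbf{E}}\varphi$ then $\vdash_{\mathbf{E}}\varphi*\rho$; (b) if $\varphi\approx\psi$ then $\varphi*\rho\approx\psi*\rho$; (c) if $\varphi\wedge\psi\approx0$ then $(\varphi*\rho)\wedge(\psi*\rho)\approx0$.
   Context: Language: variables $p_1,p_2,\dots$, constants $0,1$, connectives $\neg,\vee$ (with $\wedge,\to,\leftrightarrow$ as abbreviations), modal operator $\lozenge$, $\square\varphi:=\neg\lozenge\neg\varphi$. $\mathbf{E}$ is the smallest set of formulas containing all propositional tautologies and closed under modus ponens, uniform substitution and RE (from $\varphi\leftrightarrow\psi$ infer $\lozenge\varphi\leftrightarrow\lozenge\psi$). $\varphi\approx\psi$ means $\vdash_{\mathbf{E}}\varphi\leftrightarrow\psi$. A uniform replacement (UR) is a formula $\rho(e)$ of modal degree at most 1 in the single variable $e$. For any formula $\varphi$, $\varphi*\rho$ is defined recursively: $0*\rho=0$, $1*\rho=1$, $p_i*\rho=p_i$, $(\psi\vee\theta)*\rho=(\psi*\rho)\vee(\theta*\rho)$, $(\neg\psi)*\rho=\neg(\psi*\rho)$, $(\lozenge\psi)*\rho=\rho(\psi*\rho)$ (the result of substituting $\psi*\rho$ for $e$ in $\rho(e)$). -}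

module Defs where

open import Data.Nat using (ℕ; zero; suc; _≤_)
open import Data.Nat.Base using (_⊔_)
open import Data.Bool using (Bool; true; false; not; _∨_)
open import Relation.Binary.PropositionalEquality using (_≡_)

infixr 6 _∨̇_
data Formula : Set where
  var  : ℕ → Formula
  𝟘 𝟙  : Formula
  ¬̇_   : Formula → Formula
  _∨̇_  : Formula → Formula → Formula
  ◇    : Formula → Formula

_∧̇_ : Formula → Formula → Formula
φ ∧̇ ψ = ¬̇ (¬̇ φ ∨̇ ¬̇ ψ)

_⇒_ : Formula → Formula → Formula
φ ⇒ ψ = ¬̇ φ ∨̇ ψ

_⇔_ : Formula → Formula → Formula
φ ⇔ ψ = (φ ⇒ ψ) ∧̇ (ψ ⇒ φ)

□ : Formula → Formula
□ φ = ¬̇ ◇ (¬̇ φ)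

-- Propositional (Boolean) evaluation, treating variables and
-- ◇-formulas as propositional atoms.
eval : (ℕ → Bool) → (Formula → Bool) → Formula → Bool
eval v w (var n)  = v n
eval v w 𝟘        = false
eval v w 𝟙        = true
eval v w (¬̇ φ)    = not (eval v w φ)
eval v w (φ ∨̇ ψ)  = eval v w φ ∨ eval v w ψ
eval v w (◇ φ)    = w (◇ φ)

-- φ is a propositional tautology (instance of a classical tautology).
Tautology : Formula → Set
Tautology φ = ∀ (v : ℕ → Bool) (w : Formula → Bool) → eval v w φ ≡ true

Subst : Set
Subst = ℕ → Formula

_[_] : Formula → Subst → Formula
var n    [ σ ] = σ n
𝟘        [ σ ] = 𝟘
𝟙        [ σ ] = 𝟙
(¬̇ φ)    [ σ ] = ¬̇ (φ [ σ ])
(φ ∨̇ ψ)  [ σ ] = (φ [ σ ]) ∨̇ (ψ [ σ ])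
◇ φ      [ σ ] = ◇ (φ [ σ ])

data ⊢E_ : Formula → Set where
  taut : ∀ {φ} → Tautology φ → ⊢E φ
  mp   : ∀ {φ ψ} → ⊢E φ → ⊢E (φ ⇒ ψ) → ⊢E ψ
  us   : ∀ {φ} (σ : Subst) → ⊢E φ → ⊢E (φ [ σ ])
  re   : ∀ {φ ψ} → ⊢E (φ ⇔ ψ) → ⊢E (◇ φ ⇔ ◇ ψ)

_≈_ : Formula → Formula → Set
φ ≈ ψ = ⊢E (φ ⇔ ψ)

-- Uniform replacements: formulas ρ(e) of modal degree ≤ 1 in the single
-- variable e, where e is represented by the variable var 0.
md : Formula → ℕ
md (var n)  = 0
md 𝟘        = 0
md 𝟙        = 0
md (¬̇ φ)    = md φ
md (φ ∨̇ ψ)  = md φ ⊔ md ψ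
md (◇ φ)    = suc (md φ)

data OnlyVarE : Formula → Set where
  e   : OnlyVarE (var 0)
  c0  : OnlyVarE 𝟘
  c1  : OnlyVarE 𝟙
  neg : ∀ {φ} → OnlyVarE φ → OnlyVarE (¬̇ φ)
  or  : ∀ {φ ψ} → OnlyVarE φ → OnlyVarE ψ → OnlyVarE (φ ∨̇ ψ)
  dia : ∀ {φ} → OnlyVarE φ → OnlyVarE (◇ φ)

IsUR : Formula → Set
IsUR ρ = OnlyVarE ρ × md ρ ≤ 1
  where open import Data.Product using (_×_)

_⟨_⟩ : Formula → Formula → Formula
ρ ⟨ ψ ⟩ = ρ [ (λ { zero → ψ ; (suc n) → var (suc n) }) ]

_*_ : Formula → Formula → Formula
var n    * ρ = var n
𝟘        * ρ = 𝟘
𝟙        * ρ = 𝟙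
(¬̇ φ)    * ρ = ¬̇ (φ * ρ)
(φ ∨̇ ψ)  * ρ = (φ * ρ) ∨̇ (ψ * ρ)
◇ φ      * ρ = ρ ⟨ φ * ρ ⟩

-- Since _* ρ acts homomorphically on the
-- propositional skeleton and only rewrites ◇-atoms, it maps tautologies to
-- tautologies and commutes with modus ponens. As ρ mentions only e, it also
-- commutes with uniform substitution (σ becomes σ followed by _* ρ). Finally RE
-- turns into the congruence rule  a ⇔ b / ρ(a) ⇔ ρ(b),  which holds for every
-- ρ by induction on ρ, using RE at each ◇.
module Submission where

open import Defs
open import Data.Bool using (true; false; not; _∨_)
open import Data.List using (List; []; _∷_)
open import Data.Nat using (zero; suc)
open import Data.Product using (_×_; _,_)
open import Relation.Binary.PropositionalEquality
  using (_≡_; refl; cong; cong₂; trans; sym; subst)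

eval-* : ∀ ρ v w φ → eval v w (φ * ρ) ≡ eval v (λ ψ → eval v w (ψ * ρ)) φ
eval-* ρ v w (var n)  = refl
eval-* ρ v w 𝟘        = refl
eval-* ρ v w 𝟙        = refl
eval-* ρ v w (¬̇ φ)    = cong not (eval-* ρ v w φ)
eval-* ρ v w (φ ∨̇ ψ)  = cong₂ _∨_ (eval-* ρ v w φ) (eval-* ρ v w ψ)
eval-* ρ v w (◇ φ)    = refl

Tautology-* : ∀ ρ φ → Tautology φ → Tautology (φ * ρ)
Tautology-* ρ φ t v w = trans (eval-* ρ v w φ) (t v _)

[]-[] : ∀ φ (τ σ : Subst) → (φ [ τ ]) [ σ ] ≡ φ [ (λ n → τ n [ σ ]) ]
[]-[] (var n)  τ σ = refl
[]-[] 𝟘        τ σ = refl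
[]-[] 𝟙        τ σ = refl
[]-[] (¬̇ φ)    τ σ = cong ¬̇_ ([]-[] φ τ σ)
[]-[] (φ ∨̇ ψ)  τ σ = cong₂ _∨̇_ ([]-[] φ τ σ) ([]-[] ψ τ σ)
[]-[] (◇ φ)    τ σ = cong ◇ ([]-[] φ τ σ)

OnlyVarE-[]-cong : ∀ {ρ} → OnlyVarE ρ → (τ τ′ : Subst) → τ 0 ≡ τ′ 0 → ρ [ τ ] ≡ ρ [ τ′ ]
OnlyVarE-[]-cong e        τ τ′ eq = eq
OnlyVarE-[]-cong c0       τ τ′ eq = refl
OnlyVarE-[]-cong c1       τ τ′ eq = refl
OnlyVarE-[]-cong (neg o)  τ τ′ eq = cong ¬̇_ (OnlyVarE-[]-cong o τ τ′ eq)
OnlyVarE-[]-cong (or o p) τ τ′ eq =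
  cong₂ _∨̇_ (OnlyVarE-[]-cong o τ τ′ eq) (OnlyVarE-[]-cong p τ τ′ eq)
OnlyVarE-[]-cong (dia o)  τ τ′ eq = cong ◇ (OnlyVarE-[]-cong o τ τ′ eq)

⟨⟩-[] : ∀ {ρ} → OnlyVarE ρ → ∀ ψ (σ : Subst) → (ρ ⟨ ψ ⟩) [ σ ] ≡ ρ ⟨ ψ [ σ ] ⟩
⟨⟩-[] {ρ} o ψ σ = trans ([]-[] ρ _ σ) (OnlyVarE-[]-cong o _ _ refl)

*-[] : ∀ {ρ} → OnlyVarE ρ → ∀ φ (σ : Subst) →
       (φ [ σ ]) * ρ ≡ (φ * ρ) [ (λ n → σ n * ρ) ]
*-[] o (var n)  σ = refl
*-[] o 𝟘        σ = refl
*-[] o 𝟙        σ = refl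
*-[] o (¬̇ φ)    σ = cong ¬̇_ (*-[] o φ σ)
*-[] o (φ ∨̇ ψ)  σ = cong₂ _∨̇_ (*-[] o φ σ) (*-[] o ψ σ)
*-[] {ρ} o (◇ φ) σ =
  trans (cong (ρ ⟨_⟩) (*-[] o φ σ)) (sym (⟨⟩-[] o (φ * ρ) _))

-- Instantiates var 0, var 1, … by the listed formulas (junk value 𝟘 beyond).
instantiate : List Formula → Subst
instantiate []       n       = 𝟘
instantiate (φ ∷ φs) zero    = φ
instantiate (φ ∷ φs) (suc n) = instantiate φs n

⇔-refl-scheme ¬̇-cong-scheme ∨̇-cong-scheme : Formula
⇔-refl-scheme = var 0 ⇔ var 0
¬̇-cong-scheme = (var 0 ⇔ var 1) ⇒ ((¬̇ var 0) ⇔ (¬̇ var 1))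
∨̇-cong-scheme = (var 0 ⇔ var 1) ⇒ ((var 2 ⇔ var 3) ⇒ ((var 0 ∨̇ var 2) ⇔ (var 1 ∨̇ var 3)))

⇔-refl-taut : Tautology ⇔-refl-scheme
⇔-refl-taut v w with v 0
... | true  = refl
... | false = refl

¬̇-cong-taut : Tautology ¬̇-cong-scheme
¬̇-cong-taut v w with v 0 | v 1
... | true  | true  = refl
... | true  | false = refl
... | false | true  = refl
... | false | false = refl

∨̇-cong-taut : Tautology ∨̇-cong-scheme
∨̇-cong-taut v w with v 0 | v 1 | v 2 | v 3
... | true  | true  | true  | true  = refl
... | true  | true  | true  | false = refl
... | true  | true  | false | true  = refl
... | true  | true  | false | false = refl
... | true  | false | _     | _     = refl
... | false | true  | _     | _     = refl
... | false | false | true  | true  = refl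
... | false | false | true  | false = refl
... | false | false | false | true  = refl
... | false | false | false | false = refl

⇔-refl : ∀ φ → ⊢E (φ ⇔ φ)
⇔-refl φ = us (instantiate (φ ∷ [])) (taut {⇔-refl-scheme} ⇔-refl-taut)

⇔-cong-¬̇ : ∀ {a b} → ⊢E (a ⇔ b) → ⊢E ((¬̇ a) ⇔ (¬̇ b))
⇔-cong-¬̇ {a} {b} a⇔b =
  mp a⇔b (us (instantiate (a ∷ b ∷ [])) (taut {¬̇-cong-scheme} ¬̇-cong-taut))

⇔-cong-∨̇ : ∀ {a b c d} → ⊢E (a ⇔ b) → ⊢E (c ⇔ d) → ⊢E ((a ∨̇ c) ⇔ (b ∨̇ d))
⇔-cong-∨̇ {a} {b} {c} {d} a⇔b c⇔d =
  mp c⇔d (mp a⇔b (us (instantiate (a ∷ b ∷ c ∷ d ∷ [])) (taut {∨̇-cong-scheme} ∨̇-cong-taut)))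

⟨⟩-cong : ∀ {ρ} → OnlyVarE ρ → ∀ {a b} → ⊢E (a ⇔ b) → ⊢E ((ρ ⟨ a ⟩) ⇔ (ρ ⟨ b ⟩))
⟨⟩-cong e        a⇔b = a⇔b
⟨⟩-cong c0       a⇔b = ⇔-refl 𝟘
⟨⟩-cong c1       a⇔b = ⇔-refl 𝟙
⟨⟩-cong (neg o)  a⇔b = ⇔-cong-¬̇ (⟨⟩-cong o a⇔b)
⟨⟩-cong (or o p) a⇔b = ⇔-cong-∨̇ (⟨⟩-cong o a⇔b) (⟨⟩-cong p a⇔b)
⟨⟩-cong (dia o)  a⇔b = re (⟨⟩-cong o a⇔b)

*-⊢E : ∀ {ρ} → OnlyVarE ρ → ∀ {φ} → ⊢E φ → ⊢E (φ * ρ)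
*-⊢E {ρ} o (taut {φ} t)  = taut (Tautology-* ρ φ t)
*-⊢E o (mp ⊢φ ⊢φ⇒ψ)     = mp (*-⊢E o ⊢φ) (*-⊢E o ⊢φ⇒ψ)
*-⊢E o (us {φ} σ ⊢φ)    = subst ⊢E_ (sym (*-[] o φ σ)) (us _ (*-⊢E o ⊢φ))
*-⊢E o (re ⊢φ⇔ψ)        = ⟨⟩-cong o (*-⊢E o ⊢φ⇔ψ)

-- (b) and (c) are instances of (a): _* ρ commutes definitionally with ⇔, ∧̇ and 𝟘.
lemma7 : (ρ : Formula) → IsUR ρ → (φ ψ : Formula) →
           ((⊢E φ → ⊢E (φ * ρ))
           × (φ ≈ ψ → (φ * ρ) ≈ (ψ * ρ))
           × ((φ ∧̇ ψ) ≈ 𝟘 → ((φ * ρ) ∧̇ (ψ * ρ)) ≈ 𝟘))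
lemma7 ρ (onlyE , _) φ ψ = *-⊢E onlyE , *-⊢E onlyE , *-⊢E onlyE
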